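{- Let $n\ge 0$ and let $\varphi=f^n:\mathbb{P}^n\to\bigcup_{0\le k\le n}RG(n,k)$ be the $n$-fold iterate of the map $f$ described below. Then for all $v,w\in\mathbb{P}^n$: (i) $\varphi(w)\le w$; (ii) $\varphi(\varphi(w))=\varphi(w)$; (iii) if $v\le w$ then $\varphi(v)\le\varphi(w)$. That is, $\varphi$ is the dual of a closure operator.
   Context: $\mathbb{P}^n$ is the set of words of length $n$ with positive integer entries, ordered entrywise ($v\le w$ iff $v_i\le w_i$ for all $i$). A word $w_1\cdots w_n$ of positive integers is an $RG$-word if $w_i\le\max(0,w_1,\dots,w_{i-1})+1$ for all $i$; $RG(n,k)$ is the set of $RG$-words of length $n$ with maximal entry $k$. The map $f:\mathbb{P}^n\to\mathbb{P}^n$ is defined by: if $w$ is an $RG$-word, $f(w)=w$; otherwise let $i$ be the smallest index with $\max(0,w_1,\dots,w_{i-1})+1<w_i$, and let $f(w)$ be obtained from $w$ by replacing its $i$th entry by $\max(0,w_1,\dots,w_{i-1})+1$. (The word $f^n(w)$ is always an $RG$-word.) -}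

module Defs where

open import Data.Nat using (ℕ; zero; suc; _≤_; _<_; _⊔_; _≤?_)
open import Data.Vec using (Vec; []; _∷_)
open import Data.Vec.Relation.Unary.All using (All)
open import Data.Vec.Relation.Binary.Pointwise.Inductive using (Pointwise)
open import Relation.Nullary using (yes; no)
open import Function using (_∘_)

Positive : ∀ {n} → Vec ℕ n → Set
Positive = All (λ x → 0 < x)

_≤w_ : ∀ {n} → Vec ℕ n → Vec ℕ n → Set
_≤w_ = Pointwise _≤_

-- fFrom m w : the map f applied to w, where m = max(0, entries preceding w).
fFrom : ∀ {n} → ℕ → Vec ℕ n → Vec ℕ n
fFrom m [] = []
fFrom m (x ∷ xs) with x ≤? suc m
... | yes _ = x ∷ fFrom (m ⊔ x) xs
... | no  _ = suc m ∷ xs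

f : ∀ {n} → Vec ℕ n → Vec ℕ n
f = fFrom 0

iterate : ∀ {A : Set} → (A → A) → ℕ → A → A
iterate g zero    = λ a → a
iterate g (suc k) = g ∘ iterate g k

φ : ∀ {n} → Vec ℕ n → Vec ℕ n
φ {n} = iterate f n

-- Each application of f lowers the first offending entry to one more than the
-- maximum of its (already restricted-growth) prefix, and the entries after it
-- are untouched until it is repaired; so n applications repair every entry in
-- turn: f^k, for every k ≥ n, is the one-pass map that replaces each entry x
-- by x ⊓ (1 + maximum of the clipped prefix).
module Submission where

open import Defs
open import Data.Nat using (ℕ; zero; suc; _≤_; _⊓_; _⊔_; _≤?_; s≤s)
open import Data.Nat.Properties
  using (≤-refl; m≤n⇒m≤1+n; ≰⇒≥; m⊓n≤m; m⊓n≤n; m≤n⇒m⊓n≡m; m≥n⇒m⊓n≡n; ⊓-mono-≤; ⊔-mono-≤)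
open import Data.Vec using (Vec; []; _∷_)
open import Data.Vec.Relation.Binary.Pointwise.Inductive using ([]; _∷_)
open import Data.Product using (_×_; _,_)
open import Relation.Binary.PropositionalEquality using (_≡_; refl; cong; trans; module ≡-Reasoning)
open import Relation.Nullary using (¬_; yes; no; contradiction)

iterate-suc : ∀ {A : Set} (g : A → A) k a → iterate g (suc k) a ≡ iterate g k (g a)
iterate-suc g zero    a = refl
iterate-suc g (suc k) a = cong g (iterate-suc g k a)

clip : ∀ {n} → ℕ → Vec ℕ n → Vec ℕ n
clip m []       = []
clip m (x ∷ xs) = x ⊓ suc m ∷ clip (m ⊔ (x ⊓ suc m)) xs

clip-cons : ∀ {n} {m x y} (xs : Vec ℕ n) → x ⊓ suc m ≡ y → clip m (x ∷ xs) ≡ y ∷ clip (m ⊔ y) xs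
clip-cons xs refl = refl

clip-≤ : ∀ {n} m (w : Vec ℕ n) → clip m w ≤w w
clip-≤ m []       = []
clip-≤ m (x ∷ xs) = m⊓n≤m x (suc m) ∷ clip-≤ _ xs

clip-idem : ∀ {n} m (w : Vec ℕ n) → clip m (clip m w) ≡ clip m w
clip-idem m []       = refl
clip-idem m (x ∷ xs) =
  trans (clip-cons _ (m≤n⇒m⊓n≡m (m⊓n≤n x (suc m)))) (cong (x ⊓ suc m ∷_) (clip-idem _ xs))

clip-mono-≤ : ∀ {n m m'} {v w : Vec ℕ n} → m ≤ m' → v ≤w w → clip m v ≤w clip m' w
clip-mono-≤ m≤m' []          = []
clip-mono-≤ {m = m} {m'} {x ∷ _} {y ∷ _} m≤m' (x≤y ∷ v≤w) =
  head≤ ∷ clip-mono-≤ (⊔-mono-≤ m≤m' head≤) v≤w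
  where
  head≤ : x ⊓ suc m ≤ y ⊓ suc m'
  head≤ = ⊓-mono-≤ x≤y (s≤s m≤m')

fFrom-≤ : ∀ {n} {m x} (xs : Vec ℕ n) → x ≤ suc m → fFrom m (x ∷ xs) ≡ x ∷ fFrom (m ⊔ x) xs
fFrom-≤ {m = m} {x} xs x≤ with x ≤? suc m
... | yes _  = refl
... | no x≰ = contradiction x≤ x≰

fFrom-≰ : ∀ {n} {m x} (xs : Vec ℕ n) → ¬ x ≤ suc m → fFrom m (x ∷ xs) ≡ suc m ∷ xs
fFrom-≰ {m = m} {x} xs x≰ with x ≤? suc m
... | yes x≤ = contradiction x≤ x≰
... | no _   = refl

iterate-fFrom-[] : ∀ m k → iterate (fFrom m) k [] ≡ []
iterate-fFrom-[] m zero    = refl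
iterate-fFrom-[] m (suc k) = cong (fFrom m) (iterate-fFrom-[] m k)

iterate-fFrom-≤ : ∀ {n} {m x} (xs : Vec ℕ n) → x ≤ suc m → ∀ k →
  iterate (fFrom m) k (x ∷ xs) ≡ x ∷ iterate (fFrom (m ⊔ x)) k xs
iterate-fFrom-≤ xs x≤ zero    = refl
iterate-fFrom-≤ xs x≤ (suc k) = trans (cong (fFrom _) (iterate-fFrom-≤ xs x≤ k)) (fFrom-≤ _ x≤)

iterate-fFrom≡clip : ∀ {n k} m (w : Vec ℕ n) → n ≤ k → iterate (fFrom m) k w ≡ clip m w
iterate-fFrom≡clip {k = k} m [] _ = iterate-fFrom-[] m k
iterate-fFrom≡clip {k = suc k} m (x ∷ xs) (s≤s n≤k) with x ≤? suc m
... | yes x≤ = begin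
  iterate (fFrom m) (suc k) (x ∷ xs)    ≡⟨ iterate-fFrom-≤ xs x≤ (suc k) ⟩
  x ∷ iterate (fFrom (m ⊔ x)) (suc k) xs ≡⟨ cong (x ∷_) (iterate-fFrom≡clip _ xs (m≤n⇒m≤1+n n≤k)) ⟩
  x ∷ clip (m ⊔ x) xs                   ≡⟨ clip-cons xs (m≤n⇒m⊓n≡m x≤) ⟨
  clip m (x ∷ xs)                       ∎
  where open ≡-Reasoning
... | no x≰ = begin
  iterate (fFrom m) (suc k) (x ∷ xs)         ≡⟨ iterate-suc (fFrom m) k (x ∷ xs) ⟩
  iterate (fFrom m) k (fFrom m (x ∷ xs))     ≡⟨ cong (iterate (fFrom m) k) (fFrom-≰ xs x≰) ⟩
  iterate (fFrom m) k (suc m ∷ xs)           ≡⟨ iterate-fFrom-≤ xs ≤-refl k ⟩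
  suc m ∷ iterate (fFrom (m ⊔ suc m)) k xs   ≡⟨ cong (suc m ∷_) (iterate-fFrom≡clip _ xs n≤k) ⟩
  suc m ∷ clip (m ⊔ suc m) xs                ≡⟨ clip-cons xs (m≥n⇒m⊓n≡n (≰⇒≥ x≰)) ⟨
  clip m (x ∷ xs)                            ∎
  where open ≡-Reasoning

φ≡clip : ∀ {n} (w : Vec ℕ n) → φ w ≡ clip 0 w
φ≡clip w = iterate-fFrom≡clip 0 w ≤-refl

proposition5p3 : (n : ℕ) → (v w : Vec ℕ n) → Positive v → Positive w →
    (φ w ≤w w) × (φ (φ w) ≡ φ w) × (v ≤w w → φ v ≤w φ w)
proposition5p3 n v w _ _ rewrite φ≡clip w | φ≡clip (clip 0 w) | φ≡clip v =
  clip-≤ 0 w , clip-idem 0 w , clip-mono-≤ ≤-refl
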